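{- There exists a leader election algorithm with advice (an oracle together with a deterministic distributed algorithm) and a constant $K$ such that, for every feasible $n$-node graph $G$ with election index $\phi$, the oracle produces for $G$ a binary string of length at most $K n\log n$, and, using this advice, the algorithm performs leader election in $G$ in time $\phi$.
   Context: A graph is a simple undirected connected graph with $n\ge 3$ anonymous nodes; at each node of degree $d$ the incident edges carry distinct port numbers $0,\dots,d-1$ (local, unrelated at the two endpoints of an edge). The truncated view $\mathcal{V}^l(v)$ is defined inductively: $\mathcal{V}^0(v)$ is a single node; $\mathcal{V}^{l+1}(v)$ is the port-labeled tree rooted at $x_0$ having, for each neighbor $v_i$ of $v$, a child $x_i$ with the ports of edge $\{x_0,x_i\}$ equal to the ports of edge $\{v,v_i\}$ at $v$ and at $v_i$ respectively, and $x_i$ the root of a copy of $\mathcal{V}^l(v_i)$; the view $\mathcal{V}(v)$ is the infinite limit. The augmented truncated view $\mathcal{B}^l(v)$ is $\mathcal{V}^l(v)$ with leaves labeled by their degrees in the graph. A graph is feasible if all node views are distinct. Model: synchronous rounds (LOCAL model), all nodes start simultaneously, in each round each node exchanges arbitrary messages with all neighbors; initially a node knows only its degree and the advice. Leader election: each node $v$ outputs $(p_1,q_1,\dots,p_k,q_k)$ such that the path from $v$ whose $i$-th edge has port $p_i$ at the endpoint nearer $v$ and $q_i$ at the other endpoint is a simple path, and all these paths end at a common node. Time = number of rounds until all nodes output. The election index $\phi(G)$ is the minimum time in which leader election in $G$ is possible by a deterministic algorithm when nodes know the map of $G$ (an isomorphic copy with all port numbers); equivalently, the smallest $\ell$ such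 that all $\mathcal{B}^\ell(v)$ are distinct. Advice: an oracle knowing the entire graph $G$ (with ports) gives the same binary string to all nodes at the start; its length is the size of advice. Logarithms are base 2. -}

module Defs where

open import Data.Nat using (ℕ; zero; suc; _≤_; _<_; _*_)
open import Data.Nat.Logarithm using (⌊log₂_⌋)
open import Data.Fin using (Fin; toℕ)
open import Data.Bool using (Bool)
open import Data.List using (List; []; _∷_; tabulate; length)
open import Data.List.Relation.Unary.Unique.Propositional using (Unique)
open import Data.Maybe using (Maybe; just; nothing)
open import Data.Product using (Σ; _×_; _,_)
open import Relation.Nullary using (¬_)
open import Relation.Binary.PropositionalEquality using (_≡_; _≢_)

-- Port-labeled graphs on the (anonymous) node set Fin n.
-- Node v has degree deg v; its ports are Fin (deg v) = {0,…,deg v - 1}.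
-- nbr v p is the neighbour reached through port p at v, and
-- bport v p is the port number of that same edge at the other endpoint.

record PortGraph (n : ℕ) : Set where
  field
    deg   : Fin n → ℕ
    nbr   : (v : Fin n) → Fin (deg v) → Fin n
    bport : (v : Fin n) (p : Fin (deg v)) → Fin (deg (nbr v p))
    nbr-inv   : ∀ v p → nbr (nbr v p) (bport v p) ≡ v
    bport-inv : ∀ v p → toℕ (bport (nbr v p) (bport v p)) ≡ toℕ p

open PortGraph public

IsSimple : ∀ {n} → PortGraph n → Set
IsSimple G = (∀ v p → nbr G v p ≢ v)
           × (∀ v p q → nbr G v p ≡ nbr G v q → p ≡ q)

data Walk {n} (G : PortGraph n) : Fin n → Fin n → Set where
  here : ∀ {v} → Walk G v v
  step : ∀ {v w} (p : Fin (deg G v)) → Walk G (nbr G v p) w → Walk G v w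

Connected : ∀ {n} → PortGraph n → Set
Connected G = ∀ u v → Walk G u v

-- Port-labeled rooted trees (views).
-- bare      : an unlabeled single node (the leaves of V^l)
-- lbl d     : a leaf labeled by degree d (the leaves of B^l)
-- node cs   : a root whose child through port i (= position i in cs) is
--             given by (q , t): q is the port of that edge at the child,
--             t the subtree rooted at the child.
data PTree : Set where
  bare : PTree
  lbl  : ℕ → PTree
  node : List (ℕ × PTree) → PTree

V : ∀ {n} → PortGraph n → ℕ → Fin n → PTree
V G zero    v = bare
V G (suc l) v = node (tabulate λ p → (toℕ (bport G v p) , V G l (nbr G v p)))

B : ∀ {n} → PortGraph n → ℕ → Fin n → PTree
B G zero    v = lbl (deg G v)
B G (suc l) v = node (tabulate λ p → (toℕ (bport G v p) , B G l (nbr G v p)))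

-- feasible: all (infinite) views are distinct; two infinite views are
-- equal iff all their truncations are equal
Feasible : ∀ {n} → PortGraph n → Set
Feasible {n} G = ∀ (u v : Fin n) → (∀ l → V G l u ≡ V G l v) → u ≡ v

BDistinct : ∀ {n} → PortGraph n → ℕ → Set
BDistinct {n} G ℓ = ∀ (u v : Fin n) → B G ℓ u ≡ B G ℓ v → u ≡ v

IsElectionIndex : ∀ {n} → PortGraph n → ℕ → Set
IsElectionIndex G φ = BDistinct G φ × (∀ ℓ → ℓ < φ → ¬ BDistinct G ℓ)

-- PortPath G v ps w ns : following the sequence ps = (p₁,q₁)…(p_k,q_k)
-- from v (p_i the port at the nearer endpoint, q_i at the farther one)
-- is a valid walk ending at w, visiting the nodes ns (in order, incl. v, w).
data PortPath {n} (G : PortGraph n) :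
       Fin n → List (ℕ × ℕ) → Fin n → List (Fin n) → Set where
  end  : ∀ {v} → PortPath G v [] v (v ∷ [])
  step : ∀ {v ps w ns} (p : Fin (deg G v)) →
         PortPath G (nbr G v p) ps w ns →
         PortPath G v ((toℕ p , toℕ (bport G v p)) ∷ ps) w (v ∷ ns)

SimplePathTo : ∀ {n} → PortGraph n → Fin n → List (ℕ × ℕ) → Fin n → Set
SimplePathTo {n} G v ps w = Σ (List (Fin n)) λ ns → PortPath G v ps w ns × Unique ns

-- In each round every node sends a (arbitrary) message on each of its
-- ports, then updates its state from the list of received messages
-- (position i = message that arrived through port i).
-- A node outputs at the first round t at which `output` of its state
-- after t rounds is defined.
record Algorithm : Set₁ where
  field
    State  : Set
    Msg    : Set
    init   : List Bool → ℕ → State          -- advice, degree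
    send   : State → ℕ → Msg                -- message sent on port p
    recv   : State → List Msg → State
    output : State → Maybe (List (ℕ × ℕ))

open Algorithm public

state : ∀ {n} (A : Algorithm) → List Bool → PortGraph n → ℕ → Fin n → State A
state A adv G zero    v = init A adv (deg G v)
state A adv G (suc t) v =
  recv A (state A adv G t v)
         (tabulate λ p → send A (state A adv G t (nbr G v p)) (toℕ (bport G v p)))

OutputsAt : ∀ {n} (A : Algorithm) → List Bool → PortGraph n →
            Fin n → ℕ → List (ℕ × ℕ) → Set
OutputsAt A adv G v t o =
  output A (state A adv G t v) ≡ just o
  × (∀ t' → t' < t → output A (state A adv G t' v) ≡ nothing)

ElectsIn : ∀ {n} → Algorithm → List Bool → PortGraph n → ℕ → Set
ElectsIn {n} A adv G T =
  Σ (Fin n) λ leader → ∀ (v : Fin n) →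
    Σ ℕ λ t → t ≤ T × Σ (List (ℕ × ℕ)) λ o →
      OutputsAt A adv G v t o × SimplePathTo G v o leader

Oracle : Set
Oracle = ∀ {n} → PortGraph n → List Bool

{-# OPTIONS --safe #-}
-- The oracle runs colour refinement on G, starting from the degrees, and records it as a list of levels of
-- split rules: "a node of colour a whose port p leads, through port q at the neighbour, to a neighbour of
-- colour b gets the fresh colour c". Each rule creates a new colour class, so there are at most n rules in
-- total, and all numbers involved are below 2(n + 1). Together with the leader's colour and a table sending each
-- final colour to the ports towards a parent on a shortest route to the leader, the advice is O(n) numbers of
-- O(log n) bits. Nodes replay one level per round. By induction, equal colours after i rounds give equal views
-- B^i, so after φ rounds all colours are distinct; then no class can be split, so there are at most φ levels,
-- and when the replay ends the final colours are distinct and name the nodes in the parent table.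
module Submission where

open import Data.Bool using (Bool; true; false)
open import Data.Empty using (⊥-elim)
open import Data.Fin as Fin using (Fin; toℕ)
open import Data.Fin.Properties using (any?; injective⇒≤; toℕ<n; toℕ-injective)
open import Data.List using (List; []; _∷_; tabulate; length; lookup; map; replicate; _++_; foldl; allFin)
open import Data.List.Membership.Propositional using (_∈_)
open import Data.List.Membership.Propositional.Properties using (∈-lookup; ∈-allFin; ∈-map⁺; ∈-map⁻)
open import Data.List.Properties using (length-++; length-replicate; ∷-injective; length-tabulate; tabulate-cong; length-map)
open import Data.List.Relation.Unary.All using (All; []; _∷_)
import Data.List.Relation.Unary.All as All
open import Data.List.Relation.Unary.All.Properties using (tabulate⁺; map⁺)
open import Data.List.Relation.Unary.AllPairs using ([]; _∷_)
open import Data.List.Relation.Unary.Any using (here; there)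
open import Data.List.Relation.Unary.Unique.Propositional using (Unique)
open import Data.Maybe using (Maybe; just; nothing)
open import Data.Maybe.Properties using (just-injective)
import Data.Maybe.Properties as Maybe
open import Data.Nat using (ℕ; zero; suc; _+_; _*_; _∸_; _^_; _≤_; _<_; z≤n; s≤s; ⌊_/2⌋)
open import Data.Nat.ListAction using (sum)
open import Data.Nat.Logarithm using (⌊log₂_⌋; ⌊log₂⌋-mono-≤; ⌊log₂[2^n]⌋≡n)
open import Data.Nat.Properties
open import Data.Nat.Tactic.RingSolver using (solve-∀)
open import Data.Product using (Σ; _×_; _,_; proj₁; proj₂; ∃)
import Data.Product.Properties as Product
open import Data.Sum using (_⊎_; inj₁; inj₂)
open import Function using (_∘_)
open import Relation.Binary.PropositionalEquality
open import Relation.Nullary using (Dec; yes; no; ¬_; contradiction)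
open import Relation.Nullary.Decidable using (_×-dec_; _⊎-dec_; ¬?; decidable-stable)
open import Relation.Unary using (Decidable)

open import Defs

lookup? : {A : Set} → List A → ℕ → Maybe A
lookup? []       _       = nothing
lookup? (x ∷ xs) zero    = just x
lookup? (x ∷ xs) (suc i) = lookup? xs i

lookup?-lookup : {A : Set} (xs : List A) (i : Fin (length xs)) →
                 lookup? xs (toℕ i) ≡ just (lookup xs i)
lookup?-lookup (x ∷ xs) Fin.zero    = refl
lookup?-lookup (x ∷ xs) (Fin.suc i) = lookup?-lookup xs i

lookup?-ext : {A : Set} (xs ys : List A) →
  (∀ (i : Fin (length xs)) → lookup? ys (toℕ i) ≡ just (lookup xs i)) →
  (∀ (i : Fin (length ys)) → lookup? xs (toℕ i) ≡ just (lookup ys i)) → xs ≡ ys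
lookup?-ext []       []       _  _  = refl
lookup?-ext []       (y ∷ ys) _  ys⊆ with () ← ys⊆ Fin.zero
lookup?-ext (x ∷ xs) []       xs⊆ _ with () ← xs⊆ Fin.zero
lookup?-ext (x ∷ xs) (y ∷ ys) xs⊆ ys⊆ =
  cong₂ _∷_ (sym (just-injective (xs⊆ Fin.zero)))
            (lookup?-ext xs ys (xs⊆ ∘ Fin.suc) (ys⊆ ∘ Fin.suc))

tabulate-transport : {A B : Set} {a b : ℕ}
  (f : Fin a → A) (g : Fin b → A) (h : Fin a → B) (k : Fin b → B) →
  (∀ i j → f i ≡ g j → h i ≡ k j) → tabulate f ≡ tabulate g → tabulate h ≡ tabulate k
tabulate-transport {a = zero}  {zero}  f g h k _ _ = refl
tabulate-transport {a = suc a} {suc b} f g h k f≡g⇒h≡k eq with head , rest ← ∷-injective eq =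
  cong₂ _∷_ (f≡g⇒h≡k Fin.zero Fin.zero head)
    (tabulate-transport (f ∘ Fin.suc) (g ∘ Fin.suc) (h ∘ Fin.suc) (k ∘ Fin.suc)
      (λ i j → f≡g⇒h≡k (Fin.suc i) (Fin.suc j)) rest)

search : {P : ℕ → Set} → Decidable P → ℕ → ℕ → ℕ
search P? i zero    = i
search P? i (suc f) with P? i
... | yes _ = i
... | no  _ = search P? (suc i) f

search-least : {P : ℕ → Set} (P? : Decidable P) (i f ℓ : ℕ) → P ℓ → i ≤ ℓ → ℓ < i + f →
               P (search P? i f) × search P? i f ≤ ℓ
search-least P? i zero    ℓ _  i≤ℓ ℓ<i+0 = ⊥-elim (<⇒≱ (subst (ℓ <_) (+-identityʳ i) ℓ<i+0) i≤ℓ)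
search-least P? i (suc f) ℓ Pℓ i≤ℓ ℓ<i+f with P? i
... | yes Pi = Pi , i≤ℓ
... | no ¬Pi with i ≟ ℓ
...   | yes refl = ⊥-elim (¬Pi Pℓ)
...   | no  i≢ℓ  = search-least P? (suc i) f ℓ Pℓ (≤∧≢⇒< i≤ℓ i≢ℓ) (subst (ℓ <_) (+-suc i f) ℓ<i+f)

odd : ℕ → Bool
odd zero          = false
odd (suc zero)    = true
odd (suc (suc x)) = odd x

bit : Bool → ℕ
bit false = 0
bit true  = 1

bit-odd+2*⌊/2⌋ : ∀ x → bit (odd x) + 2 * ⌊ x /2⌋ ≡ x
bit-odd+2*⌊/2⌋ zero          = refl
bit-odd+2*⌊/2⌋ (suc zero)    = refl
bit-odd+2*⌊/2⌋ (suc (suc x)) = trans (shift (bit (odd x)) ⌊ x /2⌋) (cong (2 +_) (bit-odd+2*⌊/2⌋ x))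
  where shift : ∀ b h → b + 2 * suc h ≡ 2 + (b + 2 * h)
        shift = solve-∀

⌊/2⌋-<-2^ : ∀ w x → x < 2 ^ suc w → ⌊ x /2⌋ < 2 ^ w
⌊/2⌋-<-2^ w x x<2^1+w = *-cancelˡ-< 2 ⌊ x /2⌋ (2 ^ w) (begin-strict
    2 * ⌊ x /2⌋               ≤⟨ m≤n+m _ (bit (odd x)) ⟩
    bit (odd x) + 2 * ⌊ x /2⌋ ≡⟨ bit-odd+2*⌊/2⌋ x ⟩
    x                         <⟨ x<2^1+w ⟩
    2 ^ suc w                 ∎)
  where open ≤-Reasoning

toBits : ℕ → ℕ → List Bool
toBits zero    x = []
toBits (suc w) x = odd x ∷ toBits w ⌊ x /2⌋

length-toBits : ∀ w x → length (toBits w x) ≡ w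
length-toBits zero    x = refl
length-toBits (suc w) x = cong suc (length-toBits w ⌊ x /2⌋)

readBits : ℕ → List Bool → ℕ × List Bool
readBits zero    bs       = 0 , bs
readBits (suc w) []       = 0 , []
readBits (suc w) (b ∷ bs) with readBits w bs
... | x , rest = bit b + 2 * x , rest

readBits-toBits : ∀ w x rest → x < 2 ^ w → readBits w (toBits w x ++ rest) ≡ (x , rest)
readBits-toBits zero    zero    rest _          = refl
readBits-toBits zero    (suc x) rest (s≤s ())
readBits-toBits (suc w) x       rest x<2^w
  rewrite readBits-toBits w ⌊ x /2⌋ rest (⌊/2⌋-<-2^ w x x<2^w) = cong (_, rest) (bit-odd+2*⌊/2⌋ x)

toBitsAll : ℕ → List ℕ → List Bool
toBitsAll w []       = []
toBitsAll w (x ∷ xs) = toBits w x ++ toBitsAll w xs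

length-toBitsAll : ∀ w xs → length (toBitsAll w xs) ≡ w * length xs
length-toBitsAll w []       = sym (*-zeroʳ w)
length-toBitsAll w (x ∷ xs) = begin
    length (toBits w x ++ toBitsAll w xs)           ≡⟨ length-++ (toBits w x) ⟩
    length (toBits w x) + length (toBitsAll w xs)   ≡⟨ cong₂ _+_ (length-toBits w x) (length-toBitsAll w xs) ⟩
    w + w * length xs                               ≡⟨ sym (*-suc w (length xs)) ⟩
    w * suc (length xs)                             ∎
  where open ≡-Reasoning

-- Reading numerals of width 0 consumes nothing, hence the fuel f.
readBitsAll : ℕ → ℕ → List Bool → List ℕ
readBitsAll w zero    bs       = []
readBitsAll w (suc f) []       = []
readBitsAll w (suc f) (b ∷ bs) with readBits w (b ∷ bs)
... | x , rest = x ∷ readBitsAll w f rest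

readBitsAll-toBitsAll : ∀ w f xs → All (_< 2 ^ suc w) xs → length xs ≤ f →
                        readBitsAll (suc w) f (toBitsAll (suc w) xs) ≡ xs
readBitsAll-toBitsAll w zero    []       _            _         = refl
readBitsAll-toBitsAll w (suc f) []       _            _         = refl
readBitsAll-toBitsAll w (suc f) (x ∷ xs) (x< ∷ xs<) (s≤s len≤) =
  trans (cong (λ (y , rest) → y ∷ readBitsAll (suc w) f rest) (readBits-toBits (suc w) x (toBitsAll (suc w) xs) x<))
        (cong (x ∷_) (readBitsAll-toBitsAll w f xs xs< len≤))

readUnary : List Bool → ℕ × List Bool
readUnary []           = 0 , []
readUnary (false ∷ bs) = 0 , bs
readUnary (true  ∷ bs) with readUnary bs
... | w , rest = suc w , rest

readUnary-replicate : ∀ w rest → readUnary (replicate w true ++ false ∷ rest) ≡ (w , rest)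
readUnary-replicate zero    rest = refl
readUnary-replicate (suc w) rest rewrite readUnary-replicate w rest = refl

encodeNumbers : ℕ → List ℕ → List Bool
encodeNumbers w xs = replicate w true ++ false ∷ toBitsAll w xs

decodeNumbers : List Bool → List ℕ
decodeNumbers bs with readUnary bs
... | w , rest = readBitsAll w (length rest) rest

decodeNumbers-encodeNumbers : ∀ w xs → All (_< 2 ^ suc w) xs →
                              decodeNumbers (encodeNumbers (suc w) xs) ≡ xs
decodeNumbers-encodeNumbers w xs xs< =
  trans (cong (λ (v , rest) → readBitsAll v (length rest) rest) (readUnary-replicate (suc w) bits))
        (readBitsAll-toBitsAll w (length bits) xs xs<
          (subst (length xs ≤_) (sym (length-toBitsAll (suc w) xs)) (m≤m+n (length xs) _)))
  where bits = toBitsAll (suc w) xs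

length-encodeNumbers : ∀ w xs → length (encodeNumbers w xs) ≡ w + suc (w * length xs)
length-encodeNumbers w xs = begin
    length (replicate w true ++ false ∷ toBitsAll w xs)         ≡⟨ length-++ (replicate w true) ⟩
    length (replicate w true) + suc (length (toBitsAll w xs))   ≡⟨ cong₂ (λ a b → a + suc b) (length-replicate w) (length-toBitsAll w xs) ⟩
    w + suc (w * length xs)                                     ∎
  where open ≡-Reasoning

record Codec (A : Set) : Set where
  field
    emit        : A → List ℕ → List ℕ
    parse       : List ℕ → A × List ℕ
    parse-emit  : ∀ a rest → parse (emit a rest) ≡ (a , rest)
    size        : A → ℕ
    length-emit : ∀ a rest → length (emit a rest) ≡ size a + length rest

open Codec

Emits : {A : Set} → Codec A → (ℕ → Set) → A → Set
Emits C P a = ∀ {rest} → All P rest → All P (emit C a rest)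

module ListCodec {A : Set} (C : Codec A) where

  emitAll : List A → List ℕ → List ℕ
  emitAll []       rest = rest
  emitAll (x ∷ xs) rest = emit C x (emitAll xs rest)

  parseMany : ℕ → List ℕ → List A × List ℕ
  parseMany zero    ns = [] , ns
  parseMany (suc k) ns =
    let x , ns′ = parse C ns ; xs , rest = parseMany k ns′ in x ∷ xs , rest

  parseMany-emitAll : ∀ xs rest → parseMany (length xs) (emitAll xs rest) ≡ (xs , rest)
  parseMany-emitAll []       rest = refl
  parseMany-emitAll (x ∷ xs) rest
    rewrite parse-emit C x (emitAll xs rest) | parseMany-emitAll xs rest = refl

  sizeAll : List A → ℕ
  sizeAll xs = sum (map (size C) xs)

  length-emitAll : ∀ xs rest → length (emitAll xs rest) ≡ sizeAll xs + length rest
  length-emitAll []       rest = refl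
  length-emitAll (x ∷ xs) rest = begin
    length (emit C x (emitAll xs rest))       ≡⟨ length-emit C x (emitAll xs rest) ⟩
    size C x + length (emitAll xs rest)       ≡⟨ cong (size C x +_) (length-emitAll xs rest) ⟩
    size C x + (sizeAll xs + length rest)     ≡⟨ sym (+-assoc (size C x) (sizeAll xs) (length rest)) ⟩
    sizeAll (x ∷ xs) + length rest            ∎
    where open ≡-Reasoning

  codec : Codec (List A)
  codec = record
    { emit        = λ xs rest → length xs ∷ emitAll xs rest
    ; parse       = λ { [] → [] , [] ; (k ∷ ns) → parseMany k ns }
    ; parse-emit  = parseMany-emitAll
    ; size        = λ xs → suc (sizeAll xs)
    ; length-emit = λ xs rest → cong suc (length-emitAll xs rest)
    }

  emits : ∀ {P : ℕ → Set} {xs} → P (length xs) → All (Emits C P) xs → Emits codec P xs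
  emits {P} P-length all P-rest = P-length ∷ emitsAll all P-rest
    where
    emitsAll : ∀ {xs rest} → All (Emits C P) xs → All P rest → All P (emitAll xs rest)
    emitsAll []           P-rest = P-rest
    emitsAll (Px ∷ Pxs) P-rest = Px (emitsAll Pxs P-rest)

listCodec : {A : Set} → Codec A → Codec (List A)
listCodec = ListCodec.codec

-- A node receives through port p the pair (port of that edge at the neighbour, colour of the neighbour).
record Rule : Set where
  constructor rule
  field
    oldColour port farPort farColour newColour : ℕ

open Rule

RuleWithin : ℕ → Rule → Set
RuleWithin M (rule a b c d e) = a < M × b < M × c < M × d < M × e < M

Fires : Rule → ℕ → List (ℕ × ℕ) → Set
Fires r c ms = c ≡ oldColour r × lookup? ms (port r) ≡ just (farPort r , farColour r)

fires? : ∀ r c ms → Dec (Fires r c ms)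
fires? r c ms = (c ≟ oldColour r) ×-dec Maybe.≡-dec (Product.≡-dec _≟_ _≟_) (lookup? ms (port r)) _

applyRule : Rule → ℕ → List (ℕ × ℕ) → ℕ
applyRule r c ms with fires? r c ms
... | yes _ = newColour r
... | no  _ = c

applyRule-fires : ∀ r c ms → Fires r c ms → applyRule r c ms ≡ newColour r
applyRule-fires r c ms fires with fires? r c ms
... | yes _     = refl
... | no ¬fires = ⊥-elim (¬fires fires)

applyRule-idle : ∀ r c ms → ¬ Fires r c ms → applyRule r c ms ≡ c
applyRule-idle r c ms ¬fires with fires? r c ms
... | yes fires = ⊥-elim (¬fires fires)
... | no _      = refl

applyRule-cases : ∀ r c ms → applyRule r c ms ≡ c ⊎ (applyRule r c ms ≡ newColour r × c ≡ oldColour r)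
applyRule-cases r c ms with fires? r c ms
... | yes (c≡old , _) = inj₂ (refl , c≡old)
... | no _            = inj₁ refl

applyRules : List Rule → ℕ → List (ℕ × ℕ) → ℕ
applyRules rs c ms = foldl (λ c r → applyRule r c ms) c rs

record Entry : Set where
  constructor entry
  field
    colour upPort upFarPort upColour : ℕ

open Entry

EntryWithin : ℕ → Entry → Set
EntryWithin M (entry a b c d) = a < M × b < M × c < M × d < M

record Advice : Set where
  constructor advice
  field
    leader : ℕ
    levels : List (List Rule)
    table  : List Entry

open Advice

ruleCodec : Codec Rule
ruleCodec = record
  { emit        = λ (rule a b c d e) rest → a ∷ b ∷ c ∷ d ∷ e ∷ rest
  ; parse       = λ { (a ∷ b ∷ c ∷ d ∷ e ∷ rest) → rule a b c d e , rest ; _ → rule 0 0 0 0 0 , [] }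
  ; parse-emit  = λ _ _ → refl
  ; size        = λ _ → 5
  ; length-emit = λ _ _ → refl
  }

entryCodec : Codec Entry
entryCodec = record
  { emit        = λ (entry a b c d) rest → a ∷ b ∷ c ∷ d ∷ rest
  ; parse       = λ { (a ∷ b ∷ c ∷ d ∷ rest) → entry a b c d , rest ; _ → entry 0 0 0 0 , [] }
  ; parse-emit  = λ _ _ → refl
  ; size        = λ _ → 4
  ; length-emit = λ _ _ → refl
  }

levelsCodec : Codec (List (List Rule))
levelsCodec = listCodec (listCodec ruleCodec)

tableCodec : Codec (List Entry)
tableCodec = listCodec entryCodec

adviceCodec : Codec Advice
adviceCodec = record
  { emit        = emitAdvice
  ; parse       = parseAdvice
  ; parse-emit  = parse-emitAdvice
  ; size        = sizeAdvice
  ; length-emit = length-emitAdvice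
  }
  where
  emitAdvice : Advice → List ℕ → List ℕ
  emitAdvice (advice l L tb) rest = l ∷ emit levelsCodec L (emit tableCodec tb rest)

  parseAdvice : List ℕ → Advice × List ℕ
  parseAdvice []       = advice 0 [] [] , []
  parseAdvice (l ∷ ns) =
    let L , ns′ = parse levelsCodec ns ; tb , rest = parse tableCodec ns′ in advice l L tb , rest

  parse-emitAdvice : ∀ a rest → parseAdvice (emitAdvice a rest) ≡ (a , rest)
  parse-emitAdvice (advice l L tb) rest
    rewrite parse-emit levelsCodec L (emit tableCodec tb rest) | parse-emit tableCodec tb rest = refl

  sizeAdvice : Advice → ℕ
  sizeAdvice (advice _ L tb) = suc (size levelsCodec L + size tableCodec tb)

  length-emitAdvice : ∀ a rest → length (emitAdvice a rest) ≡ sizeAdvice a + length rest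
  length-emitAdvice (advice l L tb) rest = cong suc (begin
    length (emit levelsCodec L (emit tableCodec tb rest))          ≡⟨ length-emit levelsCodec L _ ⟩
    size levelsCodec L + length (emit tableCodec tb rest)          ≡⟨ cong (size levelsCodec L +_) (length-emit tableCodec tb rest) ⟩
    size levelsCodec L + (size tableCodec tb + length rest)        ≡⟨ sym (+-assoc (size levelsCodec L) _ (length rest)) ⟩
    size levelsCodec L + size tableCodec tb + length rest          ∎)
    where open ≡-Reasoning

encodeAdvice : ℕ → Advice → List Bool
encodeAdvice w a = encodeNumbers w (emit adviceCodec a [])

decodeAdvice : List Bool → Advice
decodeAdvice bs = proj₁ (parse adviceCodec (decodeNumbers bs))

rulesAt : List (List Rule) → ℕ → List Rule
rulesAt []       _       = []
rulesAt (rs ∷ L) zero    = rs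
rulesAt (rs ∷ L) (suc t) = rulesAt L t

entryOf : ℕ → List Entry → Maybe Entry
entryOf c []       = nothing
entryOf c (e ∷ es) with colour e ≟ c
... | yes _ = just e
... | no  _ = entryOf c es

entryOf-∈ : ∀ {e} es → e ∈ es → (∀ {e′} → e′ ∈ es → colour e′ ≡ colour e → e′ ≡ e) →
            entryOf (colour e) es ≡ just e
entryOf-∈ {e} (e′ ∷ es) e∈ unique with colour e′ ≟ colour e | e∈
... | yes same | _          = cong just (unique (here refl) same)
... | no  diff | here refl  = contradiction refl diff
... | no  _    | there e∈es = entryOf-∈ es e∈es (unique ∘ there)

pathToLeader : ℕ → ℕ → List Entry → ℕ → List (ℕ × ℕ)
pathToLeader zero    ℓ tb c = []
pathToLeader (suc f) ℓ tb c with c ≟ ℓ | entryOf c tb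
... | yes _ | _       = []
... | no  _ | nothing = []
... | no  _ | just e  = (upPort e , upFarPort e) ∷ pathToLeader f ℓ tb (upColour e)

record NodeState : Set where
  constructor ⟨_,_,_⟩
  field
    knowledge : Advice
    round     : ℕ
    myColour  : ℕ

open NodeState

-- The table has an entry per node, so its length bounds every route.
decideOutput : NodeState → Maybe (List (ℕ × ℕ))
decideOutput ⟨ a , t , c ⟩ with t ≟ length (levels a)
... | yes _ = just (pathToLeader (length (table a)) (leader a) (table a) c)
... | no  _ = nothing

algorithm : Algorithm
algorithm = record
  { State  = NodeState
  ; Msg    = ℕ × ℕ
  ; init   = λ adv d → ⟨ decodeAdvice adv , 0 , d ⟩
  ; send   = λ s q → q , myColour s
  ; recv   = λ s ms → ⟨ knowledge s , suc (round s) , applyRules (rulesAt (levels (knowledge s)) (round s)) (myColour s) ms ⟩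
  ; output = decideOutput
  }

-- Splitting colour classes

-- Colours below base are the initial ones; the fresh ones, from base on, all remain in use.
record Palette {n : ℕ} (base : ℕ) (x : Fin n → ℕ) (next : ℕ) : Set where
  field
    base≤next : base ≤ next
    bounded   : ∀ w → x w < next
    dense     : ∀ k → base ≤ k → k < next → ∃ λ w → x w ≡ k

palette-next≤ : ∀ {n base next} {x : Fin n → ℕ} → Palette base x next → next ≤ base + n
palette-next≤ {n} {base} {next} {x} pal = begin
    next                 ≡⟨ m+[n∸m]≡n base≤next ⟨
    base + (next ∸ base) ≤⟨ +-monoʳ-≤ base (injective⇒≤ {f = owner} owner-injective) ⟩
    base + n             ∎
  where
  open Palette pal
  open ≤-Reasoning
  fresh : Fin (next ∸ base) → ℕ
  fresh k = base + toℕ k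
  fresh<next : ∀ k → fresh k < next
  fresh<next k = subst (fresh k <_) (m+[n∸m]≡n base≤next) (+-monoʳ-< base (toℕ<n k))
  owned : ∀ k → ∃ λ w → x w ≡ fresh k
  owned k = dense (fresh k) (m≤m+n base (toℕ k)) (fresh<next k)
  owner : Fin (next ∸ base) → Fin n
  owner k = proj₁ (owned k)
  owner-injective : ∀ {k k′} → owner k ≡ owner k′ → k ≡ k′
  owner-injective {k} {k′} eq = toℕ-injective (+-cancelˡ-≡ base (toℕ k) (toℕ k′)
    (trans (sym (proj₂ (owned k))) (trans (cong x eq) (proj₂ (owned k′)))))

module Splitting {n : ℕ} (sig : Fin n → List (ℕ × ℕ)) where

  refine : List Rule → (Fin n → ℕ) → Fin n → ℕ
  refine rs x w = applyRules rs (x w) (sig w)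

  Balanced : (Fin n → ℕ) → Set
  Balanced x = ∀ u v → x u ≡ x v → sig u ≡ sig v

  Unbalanced : (Fin n → ℕ) → Set
  Unbalanced x = ∃ λ u → ∃ λ v → ∃ λ (p : Fin (length (sig u))) →
                 x u ≡ x v × lookup? (sig v) (toℕ p) ≢ just (lookup (sig u) p)

  unbalanced? : ∀ x → Dec (Unbalanced x)
  unbalanced? x = any? λ u → any? λ v → any? λ p →
    (x u ≟ x v) ×-dec ¬? (Maybe.≡-dec (Product.≡-dec _≟_ _≟_) (lookup? (sig v) (toℕ p)) _)

  ¬unbalanced⇒balanced : ∀ x → ¬ Unbalanced x → Balanced x
  ¬unbalanced⇒balanced x ¬ub u v xu≡xv = lookup?-ext (sig u) (sig v)
    (λ p → decidable-stable (Maybe.≡-dec (Product.≡-dec _≟_ _≟_) _ _) λ ne → ¬ub (u , v , p , xu≡xv , ne))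
    (λ p → decidable-stable (Maybe.≡-dec (Product.≡-dec _≟_ _≟_) _ _) λ ne → ¬ub (v , u , p , sym xu≡xv , ne))

  -- The rule gives colour k to u but not to v.
  splitRule : (x : Fin n → ℕ) → ℕ → Unbalanced x → Rule
  splitRule x k (u , _ , p , _) = rule (x u) (toℕ p) (proj₁ (lookup (sig u) p)) (proj₂ (lookup (sig u) p)) k

  split : ℕ → (Fin n → ℕ) → ℕ → List Rule
  split zero    x k = []
  split (suc f) x k with unbalanced? x
  ... | no  _  = []
  ... | yes ub = splitRule x k ub ∷ split f (refine (splitRule x k ub ∷ []) x) (suc k)

  splitRule-bounded : ∀ x k ub → (∀ w → x w < k) → ∀ w → refine (splitRule x k ub ∷ []) x w < suc k
  splitRule-bounded x k ub x<k w with applyRule-cases (splitRule x k ub) (x w) (sig w)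
  ... | inj₁ kept      = subst (_< suc k) (sym kept) (m<n⇒m<1+n (x<k w))
  ... | inj₂ (new , _) = subst (_< suc k) (sym new) (n<1+n k)

  splitRule-palette : ∀ {base} x k ub → Palette base x k → Palette base (refine (splitRule x k ub ∷ []) x) (suc k)
  splitRule-palette {base} x k ub@(u , v , p , xu≡xv , ¬same) pal = record
    { base≤next = m≤n⇒m≤1+n base≤next
    ; bounded   = splitRule-bounded x k ub bounded
    ; dense     = dense′
    }
    where
    open Palette pal
    r = splitRule x k ub
    u↦k : refine (r ∷ []) x u ≡ k
    u↦k = applyRule-fires r (x u) (sig u) (refl , lookup?-lookup (sig u) p)
    v-kept : refine (r ∷ []) x v ≡ x v
    v-kept = applyRule-idle r (x v) (sig v) (¬same ∘ proj₂)
    dense′ : ∀ j → base ≤ j → j < suc k → ∃ λ w → refine (r ∷ []) x w ≡ j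
    dense′ j base≤j j≤k with j ≟ k
    ... | yes refl = u , u↦k
    ... | no j≢k with dense j base≤j (≤∧≢⇒< (≤-pred j≤k) j≢k)
    ...   | w , xw≡j with applyRule-cases r (x w) (sig w)
    ...     | inj₁ kept        = w , trans kept xw≡j
    ...     | inj₂ (_ , xw≡xu) = v , trans v-kept (trans (sym xu≡xv) (trans (sym xw≡xu) xw≡j))

  split-palette : ∀ {base} f x k → Palette base x k →
                  Palette base (refine (split f x k) x) (k + length (split f x k))
  split-palette zero x k pal = subst (Palette _ x) (sym (+-identityʳ k)) pal
  split-palette (suc f) x k pal with unbalanced? x
  ... | no  _  = subst (Palette _ x) (sym (+-identityʳ k)) pal
  ... | yes ub = subst (Palette _ _) (sym (+-suc k _)) (split-palette f _ (suc k) (splitRule-palette x k ub pal))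

  split-balanced : ∀ {base} f x k → Palette base x k → base + n < k + f → Balanced (refine (split f x k) x)
  split-balanced zero x k pal budget =
    ⊥-elim (<⇒≱ budget (subst (_≤ _) (sym (+-identityʳ k)) (palette-next≤ pal)))
  split-balanced {base} (suc f) x k pal budget with unbalanced? x
  ... | no ¬ub = ¬unbalanced⇒balanced x ¬ub
  ... | yes ub = split-balanced f _ (suc k) (splitRule-palette x k ub pal) (subst (base + n <_) (+-suc k f) budget)

  split-injective : ∀ f x k → (∀ u v → x u ≡ x v → u ≡ v) → split f x k ≡ []
  split-injective zero x k _ = refl
  split-injective (suc f) x k x-injective with unbalanced? x
  ... | no _ = refl
  ... | yes (u , v , p , xu≡xv , ¬same) with x-injective u v xu≡xv
  ...   | refl = ⊥-elim (¬same (lookup?-lookup (sig u) p))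

  SignatureWithin : ℕ → Set
  SignatureWithin M = ∀ u → length (sig u) ≤ M × All (λ (q , c) → q < M × c < M) (sig u)

  split-within : ∀ {M} f x k → SignatureWithin M → (∀ w → x w < k) → k + length (split f x k) ≤ M →
                 All (RuleWithin M) (split f x k)
  split-within zero x k _ _ _ = []
  split-within {M} (suc f) x k sig<M x<k budget with unbalanced? x
  ... | no _ = []
  ... | yes ub@(u , _ , p , _) =
      (<-≤-trans (x<k u) k≤M , <-≤-trans (toℕ<n p) (proj₁ (sig<M u)) , proj₁ entry<M , proj₂ entry<M , k<M)
      ∷ split-within f _ (suc k) sig<M (splitRule-bounded x k ub x<k) (subst (_≤ M) (+-suc k _) budget)
    where
    k<M : k < M
    k<M = <-≤-trans (m<m+n k (s≤s z≤n)) budget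
    k≤M : k ≤ M
    k≤M = <⇒≤ k<M
    entry<M : proj₁ (lookup (sig u) p) < M × proj₂ (lookup (sig u) p) < M
    entry<M = All.lookup (proj₂ (sig<M u)) (∈-lookup p)

-- Colour refinement on a graph

module Refinement {n : ℕ} (G : PortGraph n) where

  signature : (Fin n → ℕ) → Fin n → List (ℕ × ℕ)
  signature x v = tabulate λ p → toℕ (bport G v p) , x (nbr G v p)

  recolour : List Rule → (Fin n → ℕ) → Fin n → ℕ
  recolour rs x = Splitting.refine (signature x) rs x

  colouring : List (List Rule) → (Fin n → ℕ) → ℕ → Fin n → ℕ
  colouring L        x zero    = x
  colouring []       x (suc i) = x
  colouring (rs ∷ L) x (suc i) = colouring L (recolour rs x) i

  colouring-[] : ∀ x i → colouring [] x i ≡ x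
  colouring-[] x zero    = refl
  colouring-[] x (suc i) = refl

  colouring-suc : ∀ L x t v → colouring L x (suc t) v ≡ recolour (rulesAt L t) (colouring L x t) v
  colouring-suc []       x t       v = cong (λ y → y v) (sym (colouring-[] x t))
  colouring-suc (rs ∷ L) x zero    v = refl
  colouring-suc (rs ∷ L) x (suc t) v = colouring-suc L (recolour rs x) t v

  colouring-stable : ∀ L x i → length L ≤ i → colouring L x i ≡ colouring L x (length L)
  colouring-stable []       x i       _         = colouring-[] x i
  colouring-stable (rs ∷ L) x (suc i) (s≤s L≤i) = colouring-stable L (recolour rs x) i L≤i

  state-colouring : ∀ adv t v → let a = decodeAdvice adv in
                    state algorithm adv G t v ≡ ⟨ a , t , colouring (levels a) (deg G) t v ⟩
  state-colouring adv zero    v = refl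
  state-colouring adv (suc t) v = begin
      recv algorithm (state algorithm adv G t v)
        (tabulate λ p → send algorithm (state algorithm adv G t (nbr G v p)) (toℕ (bport G v p)))
    ≡⟨ cong₂ (recv algorithm) (state-colouring adv t v)
         (tabulate-cong λ p → cong (λ s → send algorithm s (toℕ (bport G v p))) (state-colouring adv t (nbr G v p))) ⟩
      ⟨ a , suc t , recolour (rulesAt (levels a) t) (colouring (levels a) (deg G) t) v ⟩
    ≡⟨ cong (λ c → ⟨ a , suc t , c ⟩) (sym (colouring-suc (levels a) (deg G) t v)) ⟩
      ⟨ a , suc t , colouring (levels a) (deg G) (suc t) v ⟩
    ∎
    where
    open ≡-Reasoning
    a = decodeAdvice adv

  Faithful : List (List Rule) → (Fin n → ℕ) → Set
  Faithful L x = ∀ i u v → colouring L x (suc i) u ≡ colouring L x (suc i) v →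
                 signature (colouring L x i) u ≡ signature (colouring L x i) v

  colouring≡⇒B≡ : ∀ L → Faithful L (deg G) →
                  ∀ i u v → colouring L (deg G) i u ≡ colouring L (deg G) i v → B G i u ≡ B G i v
  colouring≡⇒B≡ L faithful zero    u v same = cong lbl same
  colouring≡⇒B≡ L faithful (suc i) u v same =
    cong node (tabulate-transport _ _ _ _ children (faithful i u v same))
    where
    children : ∀ p q → (toℕ (bport G u p) , colouring L (deg G) i (nbr G u p)) ≡ (toℕ (bport G v q) , colouring L (deg G) i (nbr G v q)) →
               (toℕ (bport G u p) , B G i (nbr G u p)) ≡ (toℕ (bport G v q) , B G i (nbr G v q))
    children p q eq = cong₂ _,_ (cong proj₁ eq) (colouring≡⇒B≡ L faithful i _ _ (cong proj₂ eq))

  -- Degrees are at most n, fresh colours lie in [suc n, suc n + n), and splitLevels makes at most suc n levels.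
  bound : ℕ
  bound = suc n + suc n

  splitLevels : ℕ → (Fin n → ℕ) → ℕ → List (List Rule)
  splitLevels zero    x k = []
  splitLevels (suc f) x k with Splitting.split (signature x) (suc n) x k
  ... | []         = []
  ... | rs@(_ ∷ _) = rs ∷ splitLevels f (recolour rs x) (k + length rs)

  module _ {x : Fin n → ℕ} {k : ℕ} (pal : Palette (suc n) x k) where
    open Palette pal

    palette-colour< : ∀ w → x w < suc n + n
    palette-colour< w = <-≤-trans (bounded w) (palette-next≤ pal)

    level-fuel : suc n + n < k + suc n
    level-fuel = subst (_≤ k + suc n) (cong suc (+-suc n n)) (+-monoˡ-≤ (suc n) base≤next)

    level-balanced : Splitting.Balanced (signature x) (recolour (Splitting.split (signature x) (suc n) x k) x)
    level-balanced = Splitting.split-balanced (signature x) (suc n) x k pal level-fuel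

    level-palette : let rs = Splitting.split (signature x) (suc n) x k in
                    Palette (suc n) (recolour rs x) (k + length rs)
    level-palette = Splitting.split-palette (signature x) (suc n) x k pal

  fuel-step : ∀ {a} k l f → a < k + suc f → a < k + suc l + f
  fuel-step k l f a<k+1+f = <-≤-trans a<k+1+f (begin
      k + suc f       ≡⟨ +-suc k f ⟩
      suc (k + f)     ≤⟨ s≤s (+-monoˡ-≤ f (m≤m+n k l)) ⟩
      suc (k + l + f) ≡⟨ cong (_+ f) (+-suc k l) ⟨
      k + suc l + f   ∎)
    where open ≤-Reasoning

  splitLevels-faithful : ∀ f x k → Palette (suc n) x k → suc n + n < k + f → Faithful (splitLevels f x k) x
  splitLevels-faithful zero x k pal fuel = ⊥-elim (<⇒≱ fuel (subst (_≤ _) (sym (+-identityʳ k)) (palette-next≤ pal)))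
  splitLevels-faithful (suc f) x k pal fuel
    with Splitting.split (signature x) (suc n) x k | level-balanced pal | level-palette pal
  ... | [] | balanced | _ = λ i u v same →
      subst (λ y → signature y u ≡ signature y v) (sym (colouring-[] x i)) (balanced u v same)
  ... | rs@(_ ∷ rs′) | balanced | pal′ = faithful
    where
    faithful : Faithful (rs ∷ splitLevels f (recolour rs x) (k + length rs)) x
    faithful zero    = balanced
    faithful (suc i) = splitLevels-faithful f (recolour rs x) (k + length rs) pal′ (fuel-step k (length rs′) f fuel) i

  splitLevels-length : ∀ f x k → length (splitLevels f x k) ≤ f
  splitLevels-length zero    x k = z≤n
  splitLevels-length (suc f) x k with Splitting.split (signature x) (suc n) x k
  ... | []         = z≤n
  ... | rs@(_ ∷ _) = s≤s (splitLevels-length f (recolour rs x) (k + length rs))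

  splitLevels-colour< : ∀ f x k → Palette (suc n) x k → ∀ i w → colouring (splitLevels f x k) x i w < suc n + n
  splitLevels-colour< zero x k pal i w = subst (λ y → y w < _) (sym (colouring-[] x i)) (palette-colour< pal w)
  splitLevels-colour< (suc f) x k pal i w with Splitting.split (signature x) (suc n) x k | level-palette pal
  ... | []         | _    = subst (λ y → y w < _) (sym (colouring-[] x i)) (palette-colour< pal w)
  ... | rs@(_ ∷ _) | pal′ with i
  ...   | zero   = palette-colour< pal w
  ...   | suc i′ = splitLevels-colour< f (recolour rs x) (k + length rs) pal′ i′ w

  splitLevels-count : ∀ f x k → Palette (suc n) x k → k + sum (map length (splitLevels f x k)) ≤ suc n + n
  splitLevels-count zero x k pal = subst (_≤ _) (sym (+-identityʳ k)) (palette-next≤ pal)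
  splitLevels-count (suc f) x k pal with Splitting.split (signature x) (suc n) x k | level-palette pal
  ... | []         | _    = subst (_≤ _) (sym (+-identityʳ k)) (palette-next≤ pal)
  ... | rs@(_ ∷ _) | pal′ = subst (_≤ suc n + n) (+-assoc k (length rs) _)
                              (splitLevels-count f (recolour rs x) (k + length rs) pal′)

  splitLevels-injective : ∀ f x k i → (∀ u v → colouring (splitLevels f x k) x i u ≡ colouring (splitLevels f x k) x i v → u ≡ v) →
                          length (splitLevels f x k) ≤ i
  splitLevels-injective zero x k i _ = z≤n
  splitLevels-injective (suc f) x k i injective with Splitting.split (signature x) (suc n) x k in eq
  ... | [] = z≤n
  ... | rs@(_ ∷ _) with i
  ...   | zero   = contradiction (trans (sym (Splitting.split-injective (signature x) (suc n) x k injective)) eq) λ ()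
  ...   | suc i′ = s≤s (splitLevels-injective f (recolour rs x) (k + length rs) i′ injective)

  below-bound : ∀ {m} → m ≤ suc n + n → m < bound
  below-bound m≤ = <-≤-trans (s≤s m≤) (≤-reflexive (sym (+-suc (suc n) n)))

  n<bound : n < bound
  n<bound = below-bound (m≤n+m n (suc n))

  signature-within : (∀ u → deg G u ≤ n) → ∀ {x k} → Palette (suc n) x k →
                     Splitting.SignatureWithin (signature x) bound
  signature-within deg≤n {x} pal u =
      subst (_≤ bound) (sym (length-tabulate _)) (<⇒≤ (≤-<-trans (deg≤n u) n<bound))
    , tabulate⁺ λ p → ≤-<-trans (≤-trans (<⇒≤ (toℕ<n (bport G u p))) (deg≤n _)) n<bound
                    , below-bound (<⇒≤ (palette-colour< pal (nbr G u p)))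

  splitLevels-within : (∀ u → deg G u ≤ n) → ∀ f x k → Palette (suc n) x k →
                       All (λ rs → length rs < bound × All (RuleWithin bound) rs) (splitLevels f x k)
  splitLevels-within deg≤n zero x k pal = []
  splitLevels-within deg≤n (suc f) x k pal
    with Splitting.split (signature x) (suc n) x k | level-palette pal
       | Splitting.split-within (signature x) (suc n) x k (signature-within deg≤n pal) (Palette.bounded pal)
  ... | []         | _    | _      = []
  ... | rs@(_ ∷ _) | pal′ | within =
      (≤-<-trans length≤n n<bound , within (<⇒≤ (below-bound (palette-next≤ pal′))))
      ∷ splitLevels-within deg≤n f (recolour rs x) (k + length rs) pal′
    where
    length≤n : length rs ≤ n
    length≤n = +-cancelˡ-≤ (suc n) (length rs) n
      (≤-trans (+-monoˡ-≤ (length rs) (Palette.base≤next pal)) (palette-next≤ pal′))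

-- Distances to a root

module Distances {n : ℕ} (G : PortGraph n) (root : Fin n) where

  Reaches : ℕ → Fin n → Set
  Reaches zero    v = v ≡ root
  Reaches (suc k) v = v ≡ root ⊎ ∃ λ (p : Fin (deg G v)) → Reaches k (nbr G v p)

  reaches? : ∀ k v → Dec (Reaches k v)
  reaches? zero    v = v Fin.≟ root
  reaches? (suc k) v = (v Fin.≟ root) ⊎-dec any? λ p → reaches? k (nbr G v p)

  walk⇒reaches : ∀ {v} → Walk G v root → ∃ λ k → Reaches k v
  walk⇒reaches here         = 0 , refl
  walk⇒reaches (step p wlk) = let k , r = walk⇒reaches wlk in suc k , inj₂ (p , r)

  distWithin : ℕ → Fin n → ℕ
  distWithin b v = search (λ k → reaches? k v) 0 (suc b)

  distWithin-least : ∀ b k v → Reaches k v → k ≤ b → Reaches (distWithin b v) v × distWithin b v ≤ k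
  distWithin-least b k v reaches k≤b = search-least (λ k → reaches? k v) 0 (suc b) k reaches z≤n (s≤s k≤b)

  distWithin-next : ∀ b d v p → distWithin b v ≡ suc d → Reaches d (nbr G v p) → suc d ≤ b →
                    distWithin b (nbr G v p) ≡ d
  distWithin-next b d v p dv≡1+d reaches 1+d≤b with distWithin-least b d (nbr G v p) reaches (≤-trans (n≤1+n d) 1+d≤b)
  ... | reaches′ , dw≤d with distWithin b (nbr G v p) <? d
  ...   | no  dw≮d = ≤-antisym dw≤d (≮⇒≥ dw≮d)
  ...   | yes dw<d = contradiction dv≤dw (<⇒≱ (subst (suc (distWithin b (nbr G v p)) <_) (sym dv≡1+d) (s≤s dw<d)))
    where
    dv≤dw : distWithin b v ≤ suc (distWithin b (nbr G v p))
    dv≤dw = proj₂ (distWithin-least b _ v (inj₂ (p , reaches′)) (≤-trans (s≤s (<⇒≤ dw<d)) 1+d≤b))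

  distWithin-layer : ∀ b d v → distWithin b v ≡ d → Reaches d v → d ≤ b →
                     ∀ j → j ≤ d → ∃ λ w → distWithin b w ≡ j
  distWithin-layer b zero    v dv≡0   _ _ zero z≤n = v , dv≡0
  distWithin-layer b (suc d) v dv≡1+d reaches 1+d≤b j j≤1+d with j ≟ suc d
  ... | yes refl = v , dv≡1+d
  ... | no j≢1+d with reaches
  ...   | inj₁ v≡root = contradiction (trans (sym dv≡1+d) (n≤0⇒n≡0 (proj₂ (distWithin-least b 0 v v≡root z≤n)))) λ ()
  ...   | inj₂ (p , reaches′) =
          distWithin-layer b d (nbr G v p) (distWithin-next b d v p dv≡1+d reaches′ 1+d≤b) reaches′
            (≤-trans (n≤1+n d) 1+d≤b) j (≤-pred (≤∧≢⇒< j≤1+d j≢1+d))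

  -- Nodes at distances 0, 1, …, distWithin b v exist and are distinct.
  distWithin<n : ∀ b k v → Reaches k v → k ≤ b → distWithin b v < n
  distWithin<n b k v reaches k≤b = injective⇒≤ {f = λ j → proj₁ (layer j)} layer-injective
    where
    least = distWithin-least b k v reaches k≤b
    layer : (j : Fin (suc (distWithin b v))) → ∃ λ w → distWithin b w ≡ toℕ j
    layer j = distWithin-layer b _ v refl (proj₁ least) (≤-trans (proj₂ least) k≤b) (toℕ j) (≤-pred (toℕ<n j))
    layer-injective : ∀ {i j} → proj₁ (layer i) ≡ proj₁ (layer j) → i ≡ j
    layer-injective {i} {j} eq = toℕ-injective (trans (sym (proj₂ (layer i))) (trans (cong (distWithin b) eq) (proj₂ (layer j))))

  dist : Fin n → ℕ
  dist = distWithin n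

  dist-reaches : Connected G → ∀ v → Reaches (dist v) v × dist v < n
  dist-reaches connected v = proj₁ least , ≤-<-trans (proj₂ least) dk<n
    where
    k = proj₁ (walk⇒reaches (connected v root))
    reaches = proj₂ (walk⇒reaches (connected v root))
    dk<n = distWithin<n k k v reaches ≤-refl
    least = distWithin-least n (distWithin k v) v (proj₁ (distWithin-least k k v reaches ≤-refl)) (<⇒≤ dk<n)

  parent-exists : Connected G → ∀ v → v ≢ root → ∃ λ (p : Fin (deg G v)) → dist (nbr G v p) < dist v
  parent-exists connected v v≢root with dist v | dist-reaches connected v
  ... | zero  | v≡root , _ = contradiction v≡root v≢root
  ... | suc d | inj₁ v≡root , _ = contradiction v≡root v≢root
  ... | suc d | inj₂ (p , reaches) , 1+d<n =
        p , s≤s (proj₂ (distWithin-least n d (nbr G v p) reaches (<⇒≤ (<-trans (n<1+n d) 1+d<n))))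

-- A parent table pointing along shortest routes to the root

module ParentTable {n : ℕ} (G : PortGraph n) (root : Fin n) (c : Fin n → ℕ) where
  open Distances G root

  parent? : ∀ v → Dec (∃ λ (p : Fin (deg G v)) → dist (nbr G v p) < dist v)
  parent? v = any? λ p → dist (nbr G v p) <? dist v

  entryAt : Fin n → Entry
  entryAt v with parent? v
  ... | yes (p , _) = entry (c v) (toℕ p) (toℕ (bport G v p)) (c (nbr G v p))
  ... | no  _       = entry (c v) 0 0 0

  colour-entryAt : ∀ v → colour (entryAt v) ≡ c v
  colour-entryAt v with parent? v
  ... | yes _ = refl
  ... | no  _ = refl

  parentTable : List Entry
  parentTable = map entryAt (allFin n)

  parentTable-within : ∀ {M} → (∀ v → c v < M) → (∀ v → deg G v ≤ M) → All (EntryWithin M) parentTable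
  parentTable-within {M} c<M deg≤M = map⁺ (tabulate⁺ within)
    where
    within : ∀ v → EntryWithin M (entryAt v)
    within v with parent? v
    ... | yes (p , _) = c<M v , <-≤-trans (toℕ<n p) (deg≤M v) , <-≤-trans (toℕ<n (bport G v p)) (deg≤M _) , c<M _
    ... | no _        = c<M v , 0<M , 0<M , 0<M
      where 0<M = ≤-<-trans z≤n (c<M v)

  module _ (c-injective : ∀ u v → c u ≡ c v → u ≡ v) where

    entryOf-parentTable : ∀ v → entryOf (c v) parentTable ≡ just (entryAt v)
    entryOf-parentTable v = subst (λ k → entryOf k parentTable ≡ just (entryAt v)) (colour-entryAt v)
      (entryOf-∈ parentTable (∈-map⁺ entryAt (∈-allFin v)) same-colour)
      where
      same-colour : ∀ {e} → e ∈ parentTable → colour e ≡ colour (entryAt v) → e ≡ entryAt v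
      same-colour e∈ same with ∈-map⁻ entryAt e∈
      ... | w , _ , refl = cong entryAt (c-injective w v
            (trans (sym (colour-entryAt w)) (trans same (colour-entryAt v))))

    Route : Fin n → List (ℕ × ℕ) → Set
    Route v ps = ∃ λ ns → PortPath G v ps root ns × Unique ns × All (λ w → dist w ≤ dist v) ns

    route-at-root : ∀ {v} → v ≡ root → Route v []
    route-at-root refl = root ∷ [] , end , [] ∷ [] , ≤-refl ∷ []

    -- Parent pointers strictly decrease the distance, so the route they trace is simple.
    route : Connected G → ∀ f v → dist v ≤ f → Route v (pathToLeader f (c root) parentTable (c v))
    route connected zero v dv≤0 =
      route-at-root (subst (λ d → Reaches d v) (n≤0⇒n≡0 dv≤0) (proj₁ (dist-reaches connected v)))
    route connected (suc f) v dv≤1+f with c v ≟ c root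
    ... | yes same = route-at-root (c-injective v root same)
    ... | no  diff rewrite entryOf-parentTable v with parent? v
    ...   | no ¬parent = contradiction (parent-exists connected v (diff ∘ cong c)) ¬parent
    ...   | yes (p , closer) =
            let ns , path , unique , below = route connected f (nbr G v p) (≤-pred (≤-trans closer dv≤1+f))
            in v ∷ ns , step p path , All.map (v-fresh below) below ∷ unique , ≤-refl ∷ All.map (λ le → ≤-trans le (<⇒≤ closer)) below
      where
      v-fresh : ∀ {ns} → All (λ w → dist w ≤ dist (nbr G v p)) ns → ∀ {w} → dist w ≤ dist (nbr G v p) → v ≢ w
      v-fresh _ dw≤ refl = <⇒≱ closer dw≤

sum-map-const : ∀ {A : Set} c (xs : List A) → sum (map (λ _ → c) xs) ≡ c * length xs
sum-map-const c []       = sym (*-zeroʳ c)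
sum-map-const c (x ∷ xs) = trans (cong (c +_) (sum-map-const c xs)) (sym (*-suc c (length xs)))

sum-size-levels : ∀ L → ListCodec.sizeAll (listCodec ruleCodec) L ≡ length L + 5 * sum (map length L)
sum-size-levels []       = refl
sum-size-levels (rs ∷ L) = begin
    suc (sum (map (λ _ → 5) rs)) + ListCodec.sizeAll (listCodec ruleCodec) L
      ≡⟨ cong₂ (λ a b → suc a + b) (sum-map-const 5 rs) (sum-size-levels L) ⟩
    suc (5 * length rs) + (length L + 5 * sum (map length L))
      ≡⟨ regroup (length rs) (length L) (sum (map length L)) ⟩
    suc (length L) + 5 * (length rs + sum (map length L))
      ∎
  where
  open ≡-Reasoning
  regroup : ∀ a l s → suc (5 * a) + (l + 5 * s) ≡ suc l + 5 * (a + s)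
  regroup = solve-∀

size-advice : ∀ ℓ L tb → size adviceCodec (advice ℓ L tb) ≡ 3 + length L + 5 * sum (map length L) + 4 * length tb
size-advice ℓ L tb = cong suc (begin
    suc (ListCodec.sizeAll (listCodec ruleCodec) L) + suc (sum (map (λ _ → 4) tb))
      ≡⟨ cong₂ (λ a b → suc a + suc b) (sum-size-levels L) (sum-map-const 4 tb) ⟩
    suc (length L + 5 * sum (map length L)) + suc (4 * length tb)
      ≡⟨ regroup (length L) (sum (map length L)) (length tb) ⟩
    2 + length L + 5 * sum (map length L) + 4 * length tb
      ∎)
  where
  open ≡-Reasoning
  regroup : ∀ l s t → suc (l + 5 * s) + suc (4 * t) ≡ 2 + l + 5 * s + 4 * t
  regroup = solve-∀

2^-above : ∀ n → n < 2 ^ suc ⌊log₂ n ⌋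
2^-above n with 2 ^ suc ⌊log₂ n ⌋ ≤? n
... | no  2^≰n = ≰⇒> 2^≰n
... | yes 2^≤n = contradiction (subst (_≤ ⌊log₂ n ⌋) (⌊log₂[2^n]⌋≡n (suc ⌊log₂ n ⌋)) (⌊log₂⌋-mono-≤ 2^≤n)) (<-irrefl refl)

bound≤2^ : ∀ n → suc n + suc n ≤ 2 ^ suc (suc ⌊log₂ n ⌋)
bound≤2^ n = begin
    suc n + suc n                         ≤⟨ +-mono-≤ (2^-above n) (2^-above n) ⟩
    2 ^ suc ⌊log₂ n ⌋ + 2 ^ suc ⌊log₂ n ⌋ ≡⟨ cong (2 ^ suc ⌊log₂ n ⌋ +_) (+-identityʳ _) ⟨
    2 ^ suc (suc ⌊log₂ n ⌋)               ∎
  where open ≤-Reasoning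

1≤⌊log₂⌋ : ∀ n → 2 ≤ n → 1 ≤ ⌊log₂ n ⌋
1≤⌊log₂⌋ n 2≤n = subst (_≤ ⌊log₂ n ⌋) (⌊log₂[2^n]⌋≡n 1) (⌊log₂⌋-mono-≤ 2≤n)

encoding-length≤ : ∀ n l → 3 ≤ n → 1 ≤ l → suc (suc l) + suc (suc (suc l) * (4 + 10 * n)) ≤ 40 * n * l
encoding-length≤ (suc (suc (suc a))) (suc b) (s≤s (s≤s (s≤s _))) (s≤s _) = begin
    3 + b + suc ((3 + b) * (4 + 10 * (3 + a)))  ≡⟨ expand a b ⟩
    106 + 35 * b + 30 * a + 10 * (a * b)        ≤⟨ m≤m+n _ (14 + 85 * b + 10 * a + 30 * (a * b)) ⟩
    106 + 35 * b + 30 * a + 10 * (a * b) + (14 + 85 * b + 10 * a + 30 * (a * b)) ≡⟨ collect a b ⟩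
    40 * (3 + a) * (1 + b)                      ∎
  where
  open ≤-Reasoning
  expand : ∀ a b → 3 + b + suc ((3 + b) * (4 + 10 * (3 + a))) ≡ 106 + 35 * b + 30 * a + 10 * (a * b)
  expand = solve-∀
  collect : ∀ a b → 106 + 35 * b + 30 * a + 10 * (a * b) + (14 + 85 * b + 10 * a + 30 * (a * b)) ≡ 40 * (3 + a) * (1 + b)
  collect = solve-∀

degree≤n : ∀ {n} (G : PortGraph n) → IsSimple G → ∀ u → deg G u ≤ n
degree≤n G (_ , no-multi-edges) u = injective⇒≤ {f = nbr G u} λ {p} {q} → no-multi-edges u p q

ruleWithin⇒emits : ∀ {M} r → RuleWithin M r → Emits ruleCodec (_< M) r
ruleWithin⇒emits (rule _ _ _ _ _) (a , b , c , d , e) rest = a ∷ b ∷ c ∷ d ∷ e ∷ rest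

blockWithin⇒emits : ∀ {M} rs → length rs < M × All (RuleWithin M) rs → Emits (listCodec ruleCodec) (_< M) rs
blockWithin⇒emits rs (length< , rules<) = ListCodec.emits ruleCodec length< (All.map (ruleWithin⇒emits _) rules<)

entryWithin⇒emits : ∀ {M} e → EntryWithin M e → Emits entryCodec (_< M) e
entryWithin⇒emits (entry _ _ _ _) (a , b , c , d) rest = a ∷ b ∷ c ∷ d ∷ rest

decideOutput-at : ∀ a c → decideOutput ⟨ a , length (levels a) , c ⟩ ≡ just (pathToLeader (length (table a)) (leader a) (table a) c)
decideOutput-at a c with length (levels a) ≟ length (levels a)
... | yes _ = refl
... | no ne = contradiction refl ne

decideOutput-before : ∀ a t c → t < length (levels a) → decideOutput ⟨ a , t , c ⟩ ≡ nothing
decideOutput-before a t c t< with t ≟ length (levels a)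
... | yes refl = contradiction t< (<-irrefl refl)
... | no _     = refl

module Election {n : ℕ} (G : PortGraph n) (root : Fin n) where
  open Refinement G
  open Distances G root using (dist; dist-reaches)

  electionLevels : List (List Rule)
  electionLevels = splitLevels (suc n) (deg G) (suc n)

  electionTime : ℕ
  electionTime = length electionLevels

  finalColours : Fin n → ℕ
  finalColours = colouring electionLevels (deg G) electionTime

  open ParentTable G root finalColours using (parentTable; parentTable-within; route)

  oracleAdvice : Advice
  oracleAdvice = advice (finalColours root) electionLevels parentTable

  length-parentTable : length parentTable ≡ n
  length-parentTable = trans (length-map _ (allFin n)) (length-tabulate _)

  module _ (simple : IsSimple G) where

    palette₀ : Palette (suc n) (deg G) (suc n)
    palette₀ = record
      { base≤next = ≤-refl
      ; bounded   = λ w → s≤s (degree≤n G simple w)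
      ; dense     = λ k 1+n≤k k<1+n → contradiction k<1+n (≤⇒≯ 1+n≤k)
      }

    advice-size≤ : size adviceCodec oracleAdvice ≤ 4 + 10 * n
    advice-size≤ = begin
        size adviceCodec oracleAdvice
          ≡⟨ size-advice (finalColours root) electionLevels parentTable ⟩
        3 + electionTime + 5 * sum (map length electionLevels) + 4 * length parentTable
          ≤⟨ +-mono-≤ (+-mono-≤ (+-monoʳ-≤ 3 (splitLevels-length (suc n) (deg G) (suc n))) (*-monoʳ-≤ 5 rules≤n))
                      (≤-reflexive (cong (4 *_) length-parentTable)) ⟩
        3 + suc n + 5 * n + 4 * n
          ≡⟨ simplify n ⟩
        4 + 10 * n
          ∎
      where
      open ≤-Reasoning
      rules≤n : sum (map length electionLevels) ≤ n
      rules≤n = +-cancelˡ-≤ (suc n) _ _ (splitLevels-count (suc n) (deg G) (suc n) palette₀)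
      simplify : ∀ n → 3 + suc n + 5 * n + 4 * n ≡ 4 + 10 * n
      simplify = solve-∀

    advice-within : All (_< bound) (emit adviceCodec oracleAdvice [])
    advice-within =
      below-bound (<⇒≤ (splitLevels-colour< (suc n) (deg G) (suc n) palette₀ electionTime root))
      ∷ ListCodec.emits (listCodec ruleCodec) levels<
          (All.map (blockWithin⇒emits _) (splitLevels-within (degree≤n G simple) (suc n) (deg G) (suc n) palette₀))
          (ListCodec.emits entryCodec (subst (_< bound) (sym length-parentTable) n<bound)
            (All.map (entryWithin⇒emits _) (parentTable-within colour< λ v → <⇒≤ (≤-<-trans (degree≤n G simple v) n<bound))) [])
      where
      levels< : electionTime < bound
      levels< = ≤-<-trans (splitLevels-length (suc n) (deg G) (suc n)) (s≤s (m≤n+m (suc n) n))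
      colour< : ∀ v → finalColours v < bound
      colour< v = below-bound (<⇒≤ (splitLevels-colour< (suc n) (deg G) (suc n) palette₀ electionTime v))

    decodeAdvice-encodeAdvice : ∀ w → bound ≤ 2 ^ suc w → decodeAdvice (encodeAdvice (suc w) oracleAdvice) ≡ oracleAdvice
    decodeAdvice-encodeAdvice w bound≤2^ = trans
      (cong (proj₁ ∘ parse adviceCodec)
            (decodeNumbers-encodeNumbers w _ (All.map (λ x<bound → <-≤-trans x<bound bound≤2^) advice-within)))
      (cong proj₁ (parse-emit adviceCodec oracleAdvice []))

    length-encodeAdvice≤ : ∀ w → length (encodeAdvice w oracleAdvice) ≤ w + suc (w * (4 + 10 * n))
    length-encodeAdvice≤ w = begin
      length (encodeAdvice w oracleAdvice)                        ≡⟨ length-encodeNumbers w (emit adviceCodec oracleAdvice []) ⟩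
      w + suc (w * length (emit adviceCodec oracleAdvice []))     ≡⟨ cong (λ l → w + suc (w * l)) (length-emit adviceCodec oracleAdvice []) ⟩
      w + suc (w * (size adviceCodec oracleAdvice + 0))           ≤⟨ +-monoʳ-≤ w (s≤s (*-monoʳ-≤ w (≤-trans (≤-reflexive (+-identityʳ _)) advice-size≤))) ⟩
      w + suc (w * (4 + 10 * n))                                  ∎
      where open ≤-Reasoning

    module _ {φ : ℕ} (distinct : BDistinct G φ) where

      faithful : Faithful electionLevels (deg G)
      faithful = splitLevels-faithful (suc n) (deg G) (suc n) palette₀ (level-fuel palette₀)

      injective-at-φ : ∀ u v → colouring electionLevels (deg G) φ u ≡ colouring electionLevels (deg G) φ v → u ≡ v
      injective-at-φ u v same = distinct u v (colouring≡⇒B≡ electionLevels faithful φ u v same)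

      electionTime≤φ : electionTime ≤ φ
      electionTime≤φ = splitLevels-injective (suc n) (deg G) (suc n) φ injective-at-φ

      finalColours-injective : ∀ u v → finalColours u ≡ finalColours v → u ≡ v
      finalColours-injective u v same =
        injective-at-φ u v (subst (λ y → y u ≡ y v) (sym (colouring-stable electionLevels (deg G) φ electionTime≤φ)) same)

      elects : Connected G → ∀ w → bound ≤ 2 ^ suc w → ElectsIn algorithm (encodeAdvice (suc w) oracleAdvice) G φ
      elects connected w bound≤2^ =
        root , λ v → electionTime , electionTime≤φ , path v , (output-at v , output-before v) , simple-path v
        where
        bits = encodeAdvice (suc w) oracleAdvice
        path : Fin n → List (ℕ × ℕ)
        path v = pathToLeader (length parentTable) (finalColours root) parentTable (finalColours v)
        output≡ : ∀ t v → output algorithm (state algorithm bits G t v) ≡ decideOutput ⟨ oracleAdvice , t , colouring electionLevels (deg G) t v ⟩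
        output≡ t v = trans (cong decideOutput (state-colouring bits t v))
          (cong (λ a → decideOutput ⟨ a , t , colouring (levels a) (deg G) t v ⟩) (decodeAdvice-encodeAdvice w bound≤2^))
        output-at : ∀ v → output algorithm (state algorithm bits G electionTime v) ≡ just (path v)
        output-at v = trans (output≡ electionTime v) (decideOutput-at oracleAdvice (finalColours v))
        output-before : ∀ v t → t < electionTime → output algorithm (state algorithm bits G t v) ≡ nothing
        output-before v t t< = trans (output≡ t v) (decideOutput-before oracleAdvice t _ t<)
        simple-path : ∀ v → SimplePathTo G v (path v) root
        simple-path v =
          let ns , walk , unique , _ = route finalColours-injective connected (length parentTable) v
                (subst (dist v ≤_) (sym length-parentTable) (<⇒≤ (proj₂ (dist-reaches connected v))))
          in ns , walk , unique

oracle : Oracle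
oracle {zero}  G = []
oracle {suc m} G = encodeAdvice (suc (suc ⌊log₂ suc m ⌋)) (Election.oracleAdvice G Fin.zero)

theorem1 : Σ Algorithm λ A → Σ Oracle λ O → Σ ℕ λ K →
    ∀ (n : ℕ) (G : PortGraph n) → 3 ≤ n → IsSimple G → Connected G →
    Feasible G → ∀ (φ : ℕ) → IsElectionIndex G φ →
    (length (O G) ≤ K * n * ⌊log₂ n ⌋) × ElectsIn A (O G) G φ
theorem1 = algorithm , oracle , 40 , election
  where
  election : ∀ (n : ℕ) (G : PortGraph n) → 3 ≤ n → IsSimple G → Connected G →
    Feasible G → ∀ (φ : ℕ) → IsElectionIndex G φ →
    (length (oracle G) ≤ 40 * n * ⌊log₂ n ⌋) × ElectsIn algorithm (oracle G) G φ
  election n@(suc _) G 3≤n simple connected _ φ (distinct , _) =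
      ≤-trans (length-encodeAdvice≤ simple (2 + ℓ))
              (encoding-length≤ n ℓ 3≤n (1≤⌊log₂⌋ n (≤-trans (n≤1+n 2) 3≤n)))
    , elects simple distinct connected (suc ℓ) (bound≤2^ n)
    where
    open Election G Fin.zero
    ℓ = ⌊log₂ n ⌋
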